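{- Every connected graph $G$ on $n$ vertices with maximum degree $\Delta$ satisfies $\gamma_I^p(G)\ge 2n/(\Delta+2)$.
   Context: For a graph $G=(V,E)$ and $v\in V$, $N(v)$ denotes the set of neighbours of $v$. A perfect Italian dominating function (PID-function) of $G$ is a function $f:V\to\{0,1,2\}$ such that for every vertex $v$ with $f(v)=0$ one has $\sum_{u\in N(v)} f(u)=2$. The weight of $f$ is $\sum_{v\in V} f(v)$; $\gamma_I^p(G)$ is the minimum weight of a PID-function of $G$. -}

module Defs where

open import Data.Nat using (ℕ; _+_; _*_; _⊔_; _≤_)
open import Data.Fin using (Fin; toℕ)
open import Data.Bool using (Bool; true; false; if_then_else_; T; not)
open import Data.List using (List; map; allFin; foldr)
open import Data.Nat.ListAction using (sum)
open import Relation.Binary.PropositionalEquality using (_≡_)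
open import Relation.Binary.Construct.Closure.ReflexiveTransitive using (Star)

record Graph (n : ℕ) : Set where
  field
    adj   : Fin n → Fin n → Bool
    sym   : ∀ u v → adj u v ≡ adj v u
    irrefl : ∀ v → adj v v ≡ false
open Graph public

Σv : {n : ℕ} → (Fin n → ℕ) → ℕ
Σv {n} g = sum (map g (allFin n))

Adj : {n : ℕ} → Graph n → Fin n → Fin n → Set
Adj G u v = T (adj G u v)

Connected : {n : ℕ} → Graph n → Set
Connected {n} G = ∀ (u v : Fin n) → Star (Adj G) u v

degree : {n : ℕ} → Graph n → Fin n → ℕ
degree G v = Σv (λ u → if adj G v u then 1 else 0)

maxDegree : {n : ℕ} → Graph n → ℕ
maxDegree {n} G = foldr _⊔_ 0 (map (degree G) (allFin n))

nbrSum : {n : ℕ} → Graph n → (Fin n → Fin 3) → Fin n → ℕ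
nbrSum G f v = Σv (λ u → if adj G v u then toℕ (f u) else 0)

-- f : V → {0,1,2} is a perfect Italian dominating function
IsPID : {n : ℕ} → Graph n → (Fin n → Fin 3) → Set
IsPID {n} G f = ∀ (v : Fin n) → toℕ (f v) ≡ 0 → nbrSum G f v ≡ 2

weight : {n : ℕ} → (Fin n → Fin 3) → ℕ
weight f = Σv (λ v → toℕ (f v))

-- Charge each vertex v with the f-weight of its neighbourhood
-- plus 2 f(v). The charge is at least 2: it is exactly 2 when f(v) = 0 by the
-- PID condition, and 2 f(v) ≥ 2 otherwise. Summed over v, the neighbourhood
-- part counts every u exactly deg(u) ≤ Δ times, so 2n ≤ Δ w(f) + 2 w(f).
module Submission where

open import Defs
open import Data.Nat using (ℕ; _+_; _*_; _≤_; _⊔_; zero; suc; z≤n; s≤s)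
open import Data.Nat.Properties
open import Data.Fin using (Fin; toℕ)
open import Data.List using (List; []; _∷_; map; allFin; foldr; length)
open import Data.Nat.ListAction using (sum)
open import Data.List.Properties using (map-cong; length-tabulate)
open import Data.Bool using (true; false; if_then_else_)
open import Data.List.Membership.Propositional using (_∈_)
open import Data.List.Membership.Propositional.Properties using (∈-allFin)
open import Data.List.Relation.Unary.Any using (here; there)
open import Algebra.Properties.CommutativeSemigroup +-commutativeSemigroup
  using () renaming (interchange to +-interchange)
open import Relation.Binary.PropositionalEquality
  using (_≡_; refl; cong; cong₂; trans; module ≡-Reasoning)
  renaming (sym to ≡-sym)

module _ {A : Set} where

  sum-map-cong : ∀ {g h : A → ℕ} (xs : List A) → (∀ x → g x ≡ h x) →
                 sum (map g xs) ≡ sum (map h xs)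
  sum-map-cong xs g≗h = cong sum (map-cong g≗h xs)

  sum-map-mono : ∀ {g h : A → ℕ} (xs : List A) → (∀ x → g x ≤ h x) →
                 sum (map g xs) ≤ sum (map h xs)
  sum-map-mono []       g≤h = z≤n
  sum-map-mono (x ∷ xs) g≤h = +-mono-≤ (g≤h x) (sum-map-mono xs g≤h)

  sum-map-const : ∀ c (xs : List A) → sum (map (λ _ → c) xs) ≡ c * length xs
  sum-map-const c []       = ≡-sym (*-zeroʳ c)
  sum-map-const c (x ∷ xs) = begin
    c + sum (map (λ _ → c) xs) ≡⟨ cong (c +_) (sum-map-const c xs) ⟩
    c + c * length xs          ≡⟨ *-suc c (length xs) ⟨
    c * suc (length xs)        ∎
    where open ≡-Reasoning

  sum-map-+ : ∀ (g h : A → ℕ) xs →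
              sum (map (λ x → g x + h x) xs) ≡ sum (map g xs) + sum (map h xs)
  sum-map-+ g h []       = refl
  sum-map-+ g h (x ∷ xs) =
    trans (cong (g x + h x +_) (sum-map-+ g h xs)) (+-interchange (g x) (h x) _ _)

  sum-map-*ʳ : ∀ c (g : A → ℕ) xs → sum (map (λ x → g x * c) xs) ≡ sum (map g xs) * c
  sum-map-*ʳ c g []       = refl
  sum-map-*ʳ c g (x ∷ xs) =
    trans (cong (g x * c +_) (sum-map-*ʳ c g xs)) (≡-sym (*-distribʳ-+ c (g x) _))

  ∈⇒≤foldr-⊔ : ∀ (g : A → ℕ) {x xs} → x ∈ xs → g x ≤ foldr _⊔_ 0 (map g xs)
  ∈⇒≤foldr-⊔ g               (here refl) = m≤m⊔n (g _) _
  ∈⇒≤foldr-⊔ g {xs = y ∷ _} (there p)   = ≤-trans (∈⇒≤foldr-⊔ g p) (m≤n⊔m (g y) _)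

module _ {A B : Set} where

  sum-map-comm : ∀ (F : A → B → ℕ) xs ys →
                 sum (map (λ x → sum (map (F x) ys)) xs) ≡
                 sum (map (λ y → sum (map (λ x → F x y) xs)) ys)
  sum-map-comm F []       ys = ≡-sym (trans (sum-map-const 0 ys) (*-zeroˡ (length ys)))
  sum-map-comm F (x ∷ xs) ys =
    trans (cong (sum (map (F x) ys) +_) (sum-map-comm F xs ys))
          (≡-sym (sum-map-+ (F x) (λ y → sum (map (λ x → F x y) xs)) ys))

Σv-const : ∀ {n} c → Σv {n} (λ _ → c) ≡ c * n
Σv-const {n} c = trans (sum-map-const c (allFin n)) (cong (c *_) (length-tabulate (λ i → i)))

degree≤maxDegree : ∀ {n} (G : Graph n) v → degree G v ≤ maxDegree G
degree≤maxDegree G v = ∈⇒≤foldr-⊔ (degree G) (∈-allFin v)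

sum-nbrSum≡sum-*-degree : ∀ {n} (G : Graph n) (f : Fin n → Fin 3) →
  Σv (nbrSum G f) ≡ Σv (λ u → toℕ (f u) * degree G u)
sum-nbrSum≡sum-*-degree {n} G f = begin
  Σv (λ v → Σv (λ u → if adj G v u then toℕ (f u) else 0))
    ≡⟨ sum-map-comm (λ v u → if adj G v u then toℕ (f u) else 0) V V ⟩
  Σv (λ u → Σv (λ v → if adj G v u then toℕ (f u) else 0))
    ≡⟨ sum-map-cong V (λ u → sum-map-cong V (edge-term u)) ⟩
  Σv (λ u → Σv (λ v → (if adj G u v then 1 else 0) * toℕ (f u)))
    ≡⟨ sum-map-cong V (λ u → sum-map-*ʳ (toℕ (f u)) (λ v → if adj G u v then 1 else 0) V) ⟩
  Σv (λ u → degree G u * toℕ (f u))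
    ≡⟨ sum-map-cong V (λ u → *-comm (degree G u) (toℕ (f u))) ⟩
  Σv (λ u → toℕ (f u) * degree G u) ∎
  where
  open ≡-Reasoning
  V = allFin n
  edge-term : ∀ u v →
    (if adj G v u then toℕ (f u) else 0) ≡ (if adj G u v then 1 else 0) * toℕ (f u)
  edge-term u v rewrite Graph.sym G v u with adj G u v
  ... | true  = ≡-sym (+-identityʳ (toℕ (f u)))
  ... | false = refl

pid-charge≥2 : ∀ {n} (G : Graph n) (f : Fin n → Fin 3) → IsPID G f →
  ∀ v → 2 ≤ nbrSum G f v + toℕ (f v) * 2
pid-charge≥2 G f pid v with toℕ (f v) | pid v
... | zero  | nbrSum≡2 = ≤-reflexive (≡-sym (trans (+-identityʳ _) (nbrSum≡2 refl)))
... | suc k | _        = m≤n⇒m≤o+n (nbrSum G f v) (s≤s (s≤s z≤n))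

theorem29 : (n : ℕ) (G : Graph n) → Connected G →
    (f : Fin n → Fin 3) → IsPID G f →
    2 * n ≤ weight f * (maxDegree G + 2)
theorem29 n G _ f pid = begin
  2 * n
    ≡⟨ Σv-const {n} 2 ⟨
  Σv {n} (λ _ → 2)
    ≤⟨ sum-map-mono (allFin n) (pid-charge≥2 G f pid) ⟩
  Σv (λ v → nbrSum G f v + toℕ (f v) * 2)
    ≡⟨ sum-map-+ (nbrSum G f) (λ v → toℕ (f v) * 2) (allFin n) ⟩
  Σv (nbrSum G f) + Σv (λ v → toℕ (f v) * 2)
    ≡⟨ cong₂ _+_ (sum-nbrSum≡sum-*-degree G f) (sum-map-*ʳ 2 (λ v → toℕ (f v)) (allFin n)) ⟩
  Σv (λ u → toℕ (f u) * degree G u) + weight f * 2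
    ≤⟨ +-monoˡ-≤ (weight f * 2)
         (sum-map-mono (allFin n) (λ u → *-monoʳ-≤ (toℕ (f u)) (degree≤maxDegree G u))) ⟩
  Σv (λ u → toℕ (f u) * maxDegree G) + weight f * 2
    ≡⟨ cong (_+ weight f * 2) (sum-map-*ʳ (maxDegree G) (λ u → toℕ (f u)) (allFin n)) ⟩
  weight f * maxDegree G + weight f * 2
    ≡⟨ *-distribˡ-+ (weight f) (maxDegree G) 2 ⟨
  weight f * (maxDegree G + 2) ∎
  where open ≤-Reasoning
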